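{- Let $n\ge1$. The abstract simplicial complex $\mathrm{bar}(\Pi_n)$ can be collapsed onto the subcomplex $\{0,1,\ldots,n\}\star\mathrm{bar}(\Lambda_n)$.
   Context: An abstract simplicial complex is a set of finite nonempty sets such that every nonempty subset of a member is a member. $\Pi_n$ is the complex of all nonempty subsets of $\{0,1,\ldots,n\}$, $\Theta_n=\Pi_n\setminus\{\{0,1,\ldots,n\}\}$, and $\Lambda_n=\Theta_n\setminus\{\{0,1,\ldots,n-1\}\}$. The barycentric subdivision is $\mathrm{bar}(\Delta)=\{\{Q_1,\ldots,Q_r\}:r\ge1,\ Q_i\in\Delta,\ Q_1\subsetneq\cdots\subsetneq Q_r\}$. For an element $t$ not in the vertex set of a complex $\Delta$, the cone $t\star\Delta$ is obtained by adding all sets $\{t\}\cup Q$ with $Q\in\Delta$ or $Q=\emptyset$; here $t=\{0,1,\ldots,n\}$ (a vertex of $\mathrm{bar}(\Pi_n)$), so the cone is a subcomplex of $\mathrm{bar}(\Pi_n)$. A free face is a non-maximal simplex contained in exactly one maximal simplex; an elementary collapse deletes a free face together with all simplices containing it; $\Sigma$ can be collapsed onto $\Sigma'$ if a finite sequence of elementary collapses leads from $\Sigma$ to $\Sigma'$. -}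

module Defs where

open import Level using (Level; _⊔_; suc; 0ℓ)
open import Data.Nat using (ℕ)
open import Data.Fin using (Fin; fromℕ)
open import Data.Empty using (⊥)
open import Data.Product using (Σ; Σ-syntax; ∃; _×_; _,_)
open import Data.Sum using (_⊎_)
open import Data.List using (List; []; _∷_)
open import Data.List.Membership.Propositional using (_∈_)
open import Data.List.Relation.Unary.All using (All)

open import Data.List.Relation.Unary.Linked using (Linked)
open import Relation.Nullary using (¬_)
open import Relation.Binary.PropositionalEquality using (_≡_; _≢_)
open import Relation.Binary.Construct.Closure.ReflexiveTransitive using (Star)
open import Function.Bundles using (_⇔_)
import Data.Fin.Subset as S

-- A finite set of vertices is represented by a list (order and
-- repetitions irrelevant: all notions below only use membership).  All complexes
-- built below are invariant under set-equality of lists.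

Complex : Set → Set₁
Complex V = List V → Set

_⊆ₗ_ : {V : Set} → List V → List V → Set
σ ⊆ₗ τ = ∀ x → x ∈ σ → x ∈ τ

_≈ₗ_ : {V : Set} → List V → List V → Set
σ ≈ₗ τ = ∀ x → (x ∈ σ) ⇔ (x ∈ τ)

Maximal : {V : Set} → Complex V → List V → Set
Maximal Σc τ = Σc τ × (∀ ρ → Σc ρ → τ ⊆ₗ ρ → ρ ⊆ₗ τ)

FreeFace : {V : Set} → Complex V → List V → Set
FreeFace Σc σ =
  Σc σ × ¬ Maximal Σc σ ×
  (Σ[ τ ∈ _ ] (Maximal Σc τ × σ ⊆ₗ τ ×
     (∀ τ' → Maximal Σc τ' → σ ⊆ₗ τ' → τ' ≈ₗ τ)))

ElementaryCollapse : {V : Set} → Complex V → Complex V → Set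
ElementaryCollapse Σc Σc' =
  Σ[ σ ∈ _ ] (FreeFace Σc σ × (∀ ρ → Σc' ρ ⇔ (Σc ρ × ¬ (σ ⊆ₗ ρ))))

CollapsesOnto : {V : Set} → Complex V → Complex V → Set₁
CollapsesOnto = Star ElementaryCollapse

-- Complexes on the vertex set {0,…,n} = Fin (suc n); their simplices are
-- represented canonically as subsets (Data.Fin.Subset).

Π : (n : ℕ) → S.Subset (ℕ.suc n) → Set
Π n Q = S.Nonempty Q

Θ : (n : ℕ) → S.Subset (ℕ.suc n) → Set
Θ n Q = Π n Q × Q ≢ S.⊤

-- {0,…,n-1} as a subset of {0,…,n}
initSeg : (n : ℕ) → S.Subset (ℕ.suc n)
initSeg n = S.∁ S.⁅ fromℕ n ⁆

Λ : (n : ℕ) → S.Subset (ℕ.suc n) → Set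
Λ n Q = Θ n Q × Q ≢ initSeg n

bar : {m : ℕ} → (S.Subset m → Set) → Complex (S.Subset m)
bar Δ σ =
  Σ[ qs ∈ List (S.Subset _) ]
    (qs ≢ [] × All Δ qs × Linked S._⊂_ qs × σ ≈ₗ qs)

Cone : {V : Set} → V → Complex V → Complex V
Cone t Δ ρ =
  Δ ρ ⊎ (Σ[ Q ∈ List _ ] ((Q ≡ [] ⊎ Δ Q) × (∀ x → (x ∈ ρ) ⇔ (x ≡ t ⊎ x ∈ Q))))

-- Write t = {0,…,n} and F = {0,…,n-1}, both vertices of bar(Π_n).  The cone
-- t ⋆ bar(Λ_n) is exactly the set of chains not containing F, so we must collapse
-- away the star of F.  Every chain through F that misses t extends by t, since
-- every other subset is a proper subset of t: the star of F is a cone with apex t.  Pick a chain ρ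
-- through F, missing t, and maximal among such chains; its only proper coface is
-- ρ ∪ {t}, so ρ is a free face.  Deleting it leaves a complex with the same
-- properties and fewer such chains, and finitely many steps remove all of them.

module Submission where

open import Defs
open import Data.Nat using (ℕ; zero; suc; _≤_; _+_; z≤n; s≤s; s≤s⁻¹)
open import Data.Nat.Properties
  using (≤-refl; ≤-trans; +-suc; +-identityʳ; +-monoˡ-≤; m≤n+m; module ≤-Reasoning)
open import Data.Bool using (true; false)
import Data.Bool as Bool
open import Data.Fin using (zero; fromℕ)
open import Data.Fin.Properties using (¬∀⟶∃¬)
open import Data.Vec using ([]; _∷_)
import Data.Vec.Base as Vec
open import Data.Vec.Properties using (≡-dec)
open import Data.Empty using (⊥-elim)
open import Data.Product using (∃-syntax; _×_; _,_; proj₁; proj₂)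
open import Data.Sum using (_⊎_; inj₁; inj₂; [_,_]′)
open import Data.List using (List; []; _∷_; _∷ʳ_; length; filter; map; concatMap; _++_)
open import Data.List.Properties using (filter-notAll)
open import Data.List.Membership.Propositional using (_∈_; _∉_)
open import Data.List.Membership.Propositional.Properties
  using (∈-filter⁺; ∈-filter⁻; ∈-++⁺ˡ; ∈-++⁺ʳ; ∈-map⁺; ∈-concatMap⁺)
import Data.List.Membership.DecPropositional as DecMembership
import Data.List.Relation.Binary.Subset.DecPropositional as DecSubset
open import Data.List.Relation.Binary.Permutation.Propositional using (_↭_; ↭-sym)
open import Data.List.Relation.Binary.Permutation.Propositional.Properties using (∈-resp-↭; ∷↭∷ʳ)
open import Data.List.Relation.Unary.All as All using (All; []; _∷_)
import Data.List.Relation.Unary.All.Properties as All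
open import Data.List.Relation.Unary.Any as Any using (here; there)
open import Data.List.Relation.Unary.Linked using (Linked; []; [-]; _∷_; linked?)
import Data.List.Relation.Unary.Linked.Properties as Linked
open import Relation.Nullary using (¬_; Dec; yes; no; ¬?; _×-dec_)
open import Relation.Nullary.Decidable using (map′)
import Relation.Unary as U
open import Relation.Binary.PropositionalEquality using (_≡_; _≢_; refl; sym; subst)
open import Relation.Binary.Definitions
  using (DecidableEquality; Reflexive; Transitive; Decidable)
open import Relation.Binary.Construct.Closure.ReflexiveTransitive using (ε; _◅_)
open import Function.Base using (_∘_)
open import Function.Bundles using (_⇔_; mk⇔; Equivalence)
open import Function.Properties.Equivalence using ()
  renaming (refl to ⇔-refl; sym to ⇔-sym; trans to ⇔-trans)
import Data.Fin.Subset as S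
import Data.Fin.Subset.Properties as S

∈⇒≢[] : {A : Set} {x : A} {xs : List A} → x ∈ xs → xs ≢ []
∈⇒≢[] () refl

∈-∷⇔ : {A : Set} {x y : A} {xs : List A} → x ∈ y ∷ xs ⇔ (x ≡ y ⊎ x ∈ xs)
∈-∷⇔ = mk⇔ (λ { (here x≡y) → inj₁ x≡y ; (there x∈) → inj₂ x∈ })
           (λ { (inj₁ x≡y) → here x≡y ; (inj₂ x∈) → there x∈ })

↭⇒≈ : {A : Set} {xs ys : List A} → xs ↭ ys → xs ≈ₗ ys
↭⇒≈ xs↭ys _ = mk⇔ (∈-resp-↭ xs↭ys) (∈-resp-↭ (↭-sym xs↭ys))

linked-∷ʳ : {A : Set} {R : A → A → Set} {y : A} {xs : List A} →
            Linked R xs → All (λ x → R x y) xs → Linked R (xs ∷ʳ y)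
linked-∷ʳ []            []            = [-]
linked-∷ʳ [-]           (Rxy ∷ [])    = Rxy ∷ [-]
linked-∷ʳ (Rxx′ ∷ xs↗)  (_ ∷ Rxs)     = Rxx′ ∷ linked-∷ʳ xs↗ Rxs

listsUpTo : {A : Set} → ℕ → List A → List (List A)
listsUpTo zero    xs = [] ∷ []
listsUpTo (suc k) xs = [] ∷ concatMap (λ x → map (x ∷_) (listsUpTo k xs)) xs

∈-listsUpTo : {A : Set} {xs : List A} → (∀ x → x ∈ xs) →
              ∀ {k} ys → length ys ≤ k → ys ∈ listsUpTo k xs
∈-listsUpTo all∈ {zero}  []       _         = here refl
∈-listsUpTo all∈ {suc k} []       _         = here refl
∈-listsUpTo all∈ {suc k} (y ∷ ys) (s≤s len) =
  there (∈-concatMap⁺ _ (Any.map (λ { refl → ∈-map⁺ (y ∷_) (∈-listsUpTo all∈ ys len) }) (all∈ y)))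

[]-or : {A : Set} {P : List A → Set} (xs : List A) → (∀ {x} → x ∈ xs → P xs) → xs ≡ [] ⊎ P xs
[]-or []      _  = inj₁ refl
[]-or (_ ∷ _) Pxs = inj₂ (Pxs (here refl))

MaximalIn : {A : Set} → (A → A → Set) → List A → A → Set
MaximalIn _≤_ xs m = ∀ {y} → y ∈ xs → m ≤ y → y ≤ m

maximal : {A : Set} {_≤_ : A → A → Set} →
          Reflexive _≤_ → Transitive _≤_ → Decidable _≤_ →
          ∀ x xs → ∃[ m ] (m ∈ x ∷ xs × MaximalIn _≤_ (x ∷ xs) m)
maximal refl′ trans′ _≤?_ x [] = x , here refl , λ { (here refl) _ → refl′ }
maximal refl′ trans′ _≤?_ x (x′ ∷ xs) with maximal refl′ trans′ _≤?_ x′ xs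
... | m , m∈ , m-max with m ≤? x
... | yes m≤x = x , here refl , λ
  { (here refl) _ → refl′
  ; (there y∈) x≤y → trans′ (m-max y∈ (trans′ m≤x x≤y)) m≤x }
... | no m≰x = m , there m∈ , λ
  { (here refl) m≤x → ⊥-elim (m≰x m≤x)
  ; (there y∈) → m-max y∈ }

module _ {V : Set} where

  ⊆-refl : {σ : List V} → σ ⊆ₗ σ
  ⊆-refl _ x∈ = x∈

  ⊆-trans : {σ τ υ : List V} → σ ⊆ₗ τ → τ ⊆ₗ υ → σ ⊆ₗ υ
  ⊆-trans σ⊆τ τ⊆υ x = τ⊆υ x ∘ σ⊆τ x

  ≈⇒⊆ : {σ τ : List V} → σ ≈ₗ τ → σ ⊆ₗ τ
  ≈⇒⊆ σ≈τ x = Equivalence.to (σ≈τ x)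

  ≈⇒⊇ : {σ τ : List V} → σ ≈ₗ τ → τ ⊆ₗ σ
  ≈⇒⊇ σ≈τ x = Equivalence.from (σ≈τ x)

  ∷-resp-≈ : ∀ {x} {σ τ : List V} → σ ≈ₗ τ → (x ∷ σ) ≈ₗ (x ∷ τ)
  ∷-resp-≈ σ≈τ y = mk⇔ (λ { (here e) → here e ; (there y∈) → there (≈⇒⊆ σ≈τ y y∈) })
                       (λ { (here e) → here e ; (there y∈) → there (≈⇒⊇ σ≈τ y y∈) })

  DownwardClosed : Complex V → Set
  DownwardClosed K = ∀ {σ τ} → K σ → τ ⊆ₗ σ → ∃[ x ] x ∈ τ → K τ

  deletion : Complex V → List V → Complex V
  deletion K ρ σ = K σ × ¬ ρ ⊆ₗ σ

  deletion-downwardClosed : ∀ {K ρ} → DownwardClosed K → DownwardClosed (deletion K ρ)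
  deletion-downwardClosed down (kσ , ρ⊈σ) τ⊆σ inhabited =
    down kσ τ⊆σ inhabited , λ ρ⊆τ → ρ⊈σ (⊆-trans ρ⊆τ τ⊆σ)

  freeFace⇒collapse : ∀ {K L ρ} → FreeFace K ρ → (∀ σ → L σ ⇔ deletion K ρ σ) →
                      ElementaryCollapse K L
  freeFace⇒collapse free L⇔ = _ , free , L⇔

module StarCollapse {V : Set} (_≟_ : DecidableEquality V)
                    {t F : V} (F≢t : F ≢ t) where

  open DecSubset _≟_ using () renaming (_⊆?_ to _⊆ᵢ?_)

  _⊆?_ : (σ τ : List V) → Dec (σ ⊆ₗ τ)
  σ ⊆? τ = map′ (λ σ⊆τ x → σ⊆τ {x}) (λ σ⊆τ {x} → σ⊆τ x) (σ ⊆ᵢ? τ)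

  StarFace : Complex V → List V → Set
  StarFace K σ = K σ × F ∈ σ × t ∉ σ

  -- The star of F in K is a cone with apex t, and ds lists (up to ≈ₗ) the
  -- faces of K through F that miss t.
  record ConedStar (K : Complex V) (ds : List (List V)) : Set where
    field
      downwardClosed : DownwardClosed K
      apex           : ∀ {σ} → StarFace K σ → K (t ∷ σ)
      faces          : All (StarFace K) ds
      enumerates     : ∀ {σ} → StarFace K σ → ∃[ d ] (d ∈ ds × σ ≈ₗ d)

  ≢t? : U.Decidable (_≢ t)
  ≢t? x = ¬? (x ≟ t)

  dropApex : List V → List V
  dropApex = filter ≢t?

  dropApex-⊆ : ∀ σ → dropApex σ ⊆ₗ σ
  dropApex-⊆ σ _ = proj₁ ∘ ∈-filter⁻ ≢t? {xs = σ}

  ∈-dropApex : ∀ {σ x} → x ∈ σ → x ≢ t → x ∈ dropApex σ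
  ∈-dropApex = ∈-filter⁺ ≢t?

  t∉dropApex : ∀ σ → t ∉ dropApex σ
  t∉dropApex σ t∈ = proj₂ (∈-filter⁻ ≢t? {xs = σ} t∈) refl

  ≈-∷-dropApex : ∀ {σ} → t ∈ σ → ∀ x → (x ∈ σ) ⇔ (x ≡ t ⊎ x ∈ dropApex σ)
  ≈-∷-dropApex {σ} t∈σ x = mk⇔ split [ (λ { refl → t∈σ }) , dropApex-⊆ σ x ]′
    where
      split : x ∈ σ → x ≡ t ⊎ x ∈ dropApex σ
      split x∈σ with x ≟ t
      ... | yes x≡t = inj₁ x≡t
      ... | no x≢t  = inj₂ (∈-dropApex x∈σ x≢t)

  dropApex-starFace : ∀ {K σ} → DownwardClosed K → K σ → F ∈ σ → StarFace K (dropApex σ)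
  dropApex-starFace {σ = σ} down kσ F∈σ =
    down kσ (dropApex-⊆ σ) (F , F∈) , F∈ , t∉dropApex σ
    where F∈ = ∈-dropApex F∈σ F≢t

  F∉-without-starFaces : ∀ {K σ} → ConedStar K [] → K σ → F ∉ σ
  F∉-without-starFaces coned kσ F∈σ
    with ConedStar.enumerates coned (dropApex-starFace (ConedStar.downwardClosed coned) kσ F∈σ)
  ... | _ , () , _

  module _ {K : Complex V} {ds : List (List V)} (coned : ConedStar K ds) where
    open ConedStar coned

    -- Every simplex through a maximal star face ρ lies in the cone t ∷ ρ:
    -- its apex-free part is a star face containing ρ, hence equal to ρ.
    cofaces-⊆-cone : ∀ {ρ τ} → F ∈ ρ → t ∉ ρ → MaximalIn _⊆ₗ_ ds ρ →
                     K τ → ρ ⊆ₗ τ → τ ⊆ₗ (t ∷ ρ)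
    cofaces-⊆-cone {ρ} {τ} F∈ρ t∉ρ ρ-max kτ ρ⊆τ y y∈τ with y ≟ t
    ... | yes refl = here refl
    ... | no y≢t with enumerates (dropApex-starFace downwardClosed kτ (ρ⊆τ F F∈ρ))
    ... | d , d∈ , τ′≈d = there (d⊆ρ y (≈⇒⊆ τ′≈d y (∈-dropApex y∈τ y≢t)))
      where
        ρ⊆τ′ : ρ ⊆ₗ dropApex τ
        ρ⊆τ′ x x∈ρ = ∈-dropApex (ρ⊆τ x x∈ρ) λ { refl → t∉ρ x∈ρ }
        d⊆ρ : d ⊆ₗ ρ
        d⊆ρ = ρ-max d∈ (⊆-trans ρ⊆τ′ (≈⇒⊆ τ′≈d))

    maximalStarFace⇒freeFace : ∀ {ρ} → StarFace K ρ → MaximalIn _⊆ₗ_ ds ρ → FreeFace K ρ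
    maximalStarFace⇒freeFace {ρ} face@(kρ , F∈ρ , t∉ρ) ρ-max =
      kρ , ρ-not-maximal , t ∷ ρ , cone-maximal , (λ _ → there) , cone-unique
      where
        cone-⊇ : ∀ {τ} → K τ → ρ ⊆ₗ τ → τ ⊆ₗ (t ∷ ρ)
        cone-⊇ = cofaces-⊆-cone F∈ρ t∉ρ ρ-max

        ρ-not-maximal : ¬ Maximal K ρ
        ρ-not-maximal (_ , ρ-top) = t∉ρ (ρ-top (t ∷ ρ) (apex face) (λ _ → there) t (here refl))

        cone-maximal : Maximal K (t ∷ ρ)
        cone-maximal = apex face , λ τ kτ cone⊆τ → cone-⊇ kτ (λ x → cone⊆τ x ∘ there)

        cone-unique : ∀ τ → Maximal K τ → ρ ⊆ₗ τ → τ ≈ₗ (t ∷ ρ)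
        cone-unique τ (kτ , τ-top) ρ⊆τ x =
          mk⇔ (cone-⊇ kτ ρ⊆τ x) (τ-top (t ∷ ρ) (apex face) (cone-⊇ kτ ρ⊆τ) x)

  survives? : ∀ ρ → U.Decidable (λ d → ¬ ρ ⊆ₗ d)
  survives? ρ d = ¬? (ρ ⊆? d)

  survivors : List V → List (List V) → List (List V)
  survivors ρ = filter (survives? ρ)

  deletion-conedStar : ∀ {K ds ρ} → ConedStar K ds → t ∉ ρ →
                       ConedStar (deletion K ρ) (survivors ρ ds)
  deletion-conedStar {K} {ds} {ρ} coned t∉ρ = record
    { downwardClosed = deletion-downwardClosed downwardClosed
    ; apex           = λ { ((kσ , ρ⊈σ) , F∈σ , t∉σ) →
                           apex (kσ , F∈σ , t∉σ) , λ ρ⊆tσ → ρ⊈σ (ρ⊆σ ρ⊆tσ) }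
    ; faces          = All.tabulate λ d∈ →
                         let d∈ds , ρ⊈d = ∈-filter⁻ (survives? ρ) {xs = ds} d∈
                             kd , F∈d , t∉d = All.lookup faces d∈ds
                         in (kd , ρ⊈d) , F∈d , t∉d
    ; enumerates     = λ { ((kσ , ρ⊈σ) , F∈σ , t∉σ) →
                           let d , d∈ , σ≈d = enumerates (kσ , F∈σ , t∉σ)
                           in d , ∈-filter⁺ (survives? ρ) d∈ (λ ρ⊆d → ρ⊈σ (⊆-trans ρ⊆d (≈⇒⊇ σ≈d)))
                                , σ≈d }
    }
    where
      open ConedStar coned
      ρ⊆σ : ∀ {σ} → ρ ⊆ₗ (t ∷ σ) → ρ ⊆ₗ σ
      ρ⊆σ ρ⊆tσ x x∈ρ with ρ⊆tσ x x∈ρ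
      ... | here refl = ⊥-elim (t∉ρ x∈ρ)
      ... | there x∈σ = x∈σ

  avoiding-F⇔deletion : ∀ {K ρ σ} → F ∈ ρ →
                        (K σ × F ∉ σ) ⇔ (deletion K ρ σ × F ∉ σ)
  avoiding-F⇔deletion F∈ρ =
    mk⇔ (λ (kσ , F∉σ) → (kσ , λ ρ⊆σ → F∉σ (ρ⊆σ _ F∈ρ)) , F∉σ) (λ ((kσ , _) , F∉σ) → kσ , F∉σ)

  -- Collapse the maximal star face ρ into its cone t ∷ ρ and recurse on
  -- the star faces that survive; ρ itself does not, so the list shrinks.
  collapse-coned-star : ∀ N {K T} ρ₀ ds → length (ρ₀ ∷ ds) ≤ N → ConedStar K (ρ₀ ∷ ds) →
                        (∀ σ → T σ ⇔ (K σ × F ∉ σ)) → CollapsesOnto K T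
  collapse-coned-star (suc N) {K} {T} ρ₀ ds (s≤s len) coned T⇔
    with ρ , ρ∈ , ρ-max ← maximal ⊆-refl ⊆-trans _⊆?_ ρ₀ ds
    with face@(_ , F∈ρ , t∉ρ) ← All.lookup (ConedStar.faces coned) ρ∈
    with survivors ρ (ρ₀ ∷ ds) | deletion-conedStar coned t∉ρ
       | filter-notAll (survives? ρ) (ρ₀ ∷ ds) (Any.map (λ { refl ρ⊈ρ → ρ⊈ρ ⊆-refl }) ρ∈)
  ... | [] | coned′ | _ = freeFace⇒collapse free T⇔deletion ◅ ε
    where
      free = maximalStarFace⇒freeFace coned face ρ-max
      T⇔deletion : ∀ σ → T σ ⇔ deletion K ρ σ
      T⇔deletion σ = ⇔-trans (T⇔ σ) (⇔-trans (avoiding-F⇔deletion {K} F∈ρ)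
                       (mk⇔ proj₁ (λ kσ′ → kσ′ , F∉-without-starFaces coned′ kσ′)))
  ... | ρ₁ ∷ ds′ | coned′ | shorter =
    freeFace⇒collapse free (λ _ → ⇔-refl) ◅
    collapse-coned-star N ρ₁ ds′ (≤-trans (s≤s⁻¹ shorter) len) coned′
      (λ σ → ⇔-trans (T⇔ σ) (avoiding-F⇔deletion {K} F∈ρ))
    where free = maximalStarFace⇒freeFace coned face ρ-max

  collapse-vertex-star : ∀ {K T ds} → ConedStar K ds → K (F ∷ []) →
                         (∀ σ → T σ ⇔ (K σ × F ∉ σ)) → CollapsesOnto K T
  collapse-vertex-star {ds = []} coned kF _ with ConedStar.enumerates coned (kF , here refl , t∉F)
    where t∉F = λ { (here t≡F) → F≢t (sym t≡F) }
  ... | _ , () , _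
  collapse-vertex-star {ds = ρ₀ ∷ ds} coned _ T⇔ = collapse-coned-star _ ρ₀ ds ≤-refl coned T⇔

subsets : ∀ m → List (S.Subset m)
subsets zero    = [] ∷ []
subsets (suc m) = map (true ∷_) (subsets m) ++ map (false ∷_) (subsets m)

∈-subsets : ∀ {m} (p : S.Subset m) → p ∈ subsets m
∈-subsets []          = here refl
∈-subsets (true ∷ p)  = ∈-++⁺ˡ (∈-map⁺ (true ∷_) (∈-subsets p))
∈-subsets (false ∷ p) = ∈-++⁺ʳ _ (∈-map⁺ (false ∷_) (∈-subsets p))

chain-length : ∀ {m} {qs : List (S.Subset m)} → Linked S._⊂_ qs → length qs ≤ suc m
chain-length []                  = z≤n
chain-length {qs = q ∷ qs} chain = s≤s (≤-trans (m≤n+m (length qs) S.∣ q ∣) (bound chain))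
  where
    open ≤-Reasoning
    bound : ∀ {m} {q : S.Subset m} {qs} → Linked S._⊂_ (q ∷ qs) → S.∣ q ∣ + length qs ≤ m
    bound {m} {q} [-] = begin
      S.∣ q ∣ + 0  ≡⟨ +-identityʳ S.∣ q ∣ ⟩
      S.∣ q ∣      ≤⟨ S.∣p∣≤n q ⟩
      m            ∎
    bound {m} {q} {q′ ∷ qs} (q⊂q′ ∷ chain) = begin
      S.∣ q ∣ + suc (length qs)  ≡⟨ +-suc S.∣ q ∣ (length qs) ⟩
      suc (S.∣ q ∣ + length qs)  ≤⟨ +-monoˡ-≤ (length qs) (S.p⊂q⇒∣p∣<∣q∣ q⊂q′) ⟩
      S.∣ q′ ∣ + length qs       ≤⟨ bound chain ⟩
      m                          ∎

⊂-⊤ : ∀ {m} {p : S.Subset m} → p ≢ S.⊤ → p S.⊂ S.⊤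
⊂-⊤ {m} {p} p≢⊤ with ¬∀⟶∃¬ m (S._∈ p) (S._∈? p) (λ all∈ → p≢⊤ (S.⊆-antisym S.⊆⊤ (λ {x} _ → all∈ x)))
... | x , x∉p = S.⊆⊤ , x , S.∈⊤ , x∉p

_≟ₛ_ : ∀ {m} → DecidableEquality (S.Subset m)
_≟ₛ_ = ≡-dec Bool._≟_

module _ {m : ℕ} {Δ : S.Subset m → Set} where

  bar-resp-≈ : ∀ {σ τ} → σ ≈ₗ τ → bar Δ σ → bar Δ τ
  bar-resp-≈ σ≈τ (qs , qs≢[] , Δqs , chain , σ≈qs) =
    qs , qs≢[] , Δqs , chain , λ x → ⇔-trans (⇔-sym (σ≈τ x)) (σ≈qs x)

  bar-map : ∀ {Δ′ : S.Subset m → Set} → (∀ {q} → Δ q → Δ′ q) → ∀ {σ} → bar Δ σ → bar Δ′ σ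
  bar-map Δ⇒Δ′ (qs , qs≢[] , Δqs , chain , σ≈qs) = qs , qs≢[] , All.map Δ⇒Δ′ Δqs , chain , σ≈qs

  bar-vertex : ∀ {q} → Δ q → bar Δ (q ∷ [])
  bar-vertex {q} Δq = q ∷ [] , (λ ()) , Δq ∷ [] , [-] , λ _ → ⇔-refl

  bar-downwardClosed : DownwardClosed (bar Δ)
  bar-downwardClosed {τ = τ} (qs , _ , Δqs , chain , σ≈qs) τ⊆σ (x , x∈τ) =
      filter (_∈? τ) qs
    , ∈⇒≢[] (∈-filter⁺ (_∈? τ) (≈⇒⊆ σ≈qs x (τ⊆σ x x∈τ)) x∈τ)
    , All.filter⁺ (_∈? τ) Δqs
    , Linked.filter⁺ (_∈? τ) S.⊂-trans chain
    , λ y → mk⇔ (λ y∈τ → ∈-filter⁺ (_∈? τ) (≈⇒⊆ σ≈qs y (τ⊆σ y y∈τ)) y∈τ)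
                (proj₂ ∘ ∈-filter⁻ (_∈? τ) {xs = qs})
    where open DecMembership _≟ₛ_ using (_∈?_)

  bar-cone-⊤ : Δ S.⊤ → ∀ {σ} → bar Δ σ → S.⊤ ∉ σ → bar Δ (S.⊤ ∷ σ)
  bar-cone-⊤ Δ⊤ {σ} (qs , _ , Δqs , chain , σ≈qs) ⊤∉σ =
      qs ∷ʳ S.⊤
    , ∈⇒≢[] (∈-resp-↭ (∷↭∷ʳ S.⊤ qs) (here refl))
    , All.∷ʳ⁺ Δqs Δ⊤
    , linked-∷ʳ chain (All.tabulate λ q∈ → ⊂-⊤ λ { refl → ⊤∉σ (≈⇒⊇ σ≈qs _ q∈) })
    , λ x → ⇔-trans (∷-resp-≈ σ≈qs x) (↭⇒≈ (∷↭∷ʳ S.⊤ qs) x)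

initSeg≢⊤ : ∀ n → initSeg n ≢ S.⊤
initSeg≢⊤ n eq = S.x∈∁p⇒x∉p (subst (fromℕ n S.∈_) (sym eq) S.∈⊤) (S.x∈⁅x⁆ (fromℕ n))

initSeg-nonempty : ∀ {n} → 1 ≤ n → S.Nonempty (initSeg n)
initSeg-nonempty {suc n} _ = zero , Vec.here

module _ (n : ℕ) where
  open StarCollapse _≟ₛ_ (initSeg≢⊤ n)
  open DecMembership (_≟ₛ_ {suc n}) using (_∈?_)

  ⊤ₙ : S.Subset (suc n)
  ⊤ₙ = S.⊤

  StarChain : List (S.Subset (suc n)) → Set
  StarChain qs = All (Π n) qs × Linked S._⊂_ qs × initSeg n ∈ qs × ⊤ₙ ∉ qs

  starChain? : U.Decidable StarChain
  starChain? qs = All.all? S.nonempty? qs ×-dec linked? S._⊂?_ qs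
                  ×-dec initSeg n ∈? qs ×-dec ¬? (⊤ₙ ∈? qs)

  candidates : List (List (S.Subset (suc n)))
  candidates = listsUpTo (suc (suc n)) (subsets (suc n))

  starChains : List (List (S.Subset (suc n)))
  starChains = filter starChain? candidates

  bar-Π-conedStar : ConedStar (bar (Π n)) starChains
  bar-Π-conedStar = record
    { downwardClosed = bar-downwardClosed
    ; apex           = λ (b , _ , ⊤∉σ) → bar-cone-⊤ (zero , S.∈⊤) b ⊤∉σ
    ; faces          = All.tabulate λ {qs} qs∈ →
        let Πqs , chain , F∈qs , ⊤∉qs = proj₂ (∈-filter⁻ starChain? {xs = candidates} qs∈)
        in (qs , ∈⇒≢[] F∈qs , Πqs , chain , λ _ → ⇔-refl) , F∈qs , ⊤∉qs
    ; enumerates     = λ { ((qs , _ , Πqs , chain , σ≈qs) , F∈σ , ⊤∉σ) →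
        qs , ∈-filter⁺ starChain? (∈-listsUpTo ∈-subsets qs (chain-length chain))
                       (Πqs , chain , ≈⇒⊆ σ≈qs _ F∈σ , ⊤∉σ ∘ ≈⇒⊇ σ≈qs _)
           , σ≈qs }
    }

  bar-Λ-avoids : ∀ {σ} → bar (Λ n) σ → initSeg n ∉ σ × ⊤ₙ ∉ σ
  bar-Λ-avoids (_ , _ , Λqs , _ , σ≈qs) =
      (λ F∈σ → proj₂ (All.lookup Λqs (≈⇒⊆ σ≈qs _ F∈σ)) refl)
    , (λ ⊤∈σ → proj₂ (proj₁ (All.lookup Λqs (≈⇒⊆ σ≈qs _ ⊤∈σ))) refl)

  bar-Π-restrict : ∀ {σ} → bar (Π n) σ → initSeg n ∉ σ → ⊤ₙ ∉ σ → bar (Λ n) σ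
  bar-Π-restrict (qs , qs≢[] , Πqs , chain , σ≈qs) F∉σ ⊤∉σ =
    qs , qs≢[] , All.tabulate Λq , chain , σ≈qs
    where
      Λq : ∀ {q} → q ∈ qs → Λ n q
      Λq q∈ = (All.lookup Πqs q∈ , λ { refl → ⊤∉σ (≈⇒⊇ σ≈qs _ q∈) })
            , λ { refl → F∉σ (≈⇒⊇ σ≈qs _ q∈) }

  coneBase⇒bar : ∀ {Q} → Q ≡ [] ⊎ bar (Λ n) Q → bar (Π n) (⊤ₙ ∷ Q) × initSeg n ∉ Q
  coneBase⇒bar (inj₁ refl) = bar-vertex (zero , S.∈⊤) , λ ()
  coneBase⇒bar (inj₂ b) with F∉Q , ⊤∉Q ← bar-Λ-avoids b =
    bar-cone-⊤ (zero , S.∈⊤) (bar-map (proj₁ ∘ proj₁) b) ⊤∉Q , F∉Q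

  cone⇒bar : ∀ {σ} → Cone ⊤ₙ (bar (Λ n)) σ → bar (Π n) σ × initSeg n ∉ σ
  cone⇒bar (inj₁ b) = bar-map (proj₁ ∘ proj₁) b , proj₁ (bar-Λ-avoids b)
  cone⇒bar (inj₂ (Q , base , σ≈⊤Q)) with Πcone , F∉Q ← coneBase⇒bar base =
      bar-resp-≈ (λ x → ⇔-trans ∈-∷⇔ (⇔-sym (σ≈⊤Q x))) Πcone
    , λ F∈σ → [ initSeg≢⊤ n , F∉Q ]′ (Equivalence.to (σ≈⊤Q _) F∈σ)

  bar⇒cone : ∀ {σ} → bar (Π n) σ → initSeg n ∉ σ → Cone ⊤ₙ (bar (Λ n)) σ
  bar⇒cone {σ} b F∉σ with ⊤ₙ ∈? σ
  ... | no ⊤∉σ = inj₁ (bar-Π-restrict b F∉σ ⊤∉σ)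
  ... | yes ⊤∈σ = inj₂ (dropApex σ , []-or {P = bar (Λ n)} (dropApex σ) restrict , ≈-∷-dropApex ⊤∈σ)
    where
      restrict : ∀ {x} → x ∈ dropApex σ → bar (Λ n) (dropApex σ)
      restrict x∈ = bar-Π-restrict (bar-downwardClosed b (dropApex-⊆ σ) (_ , x∈))
                                   (F∉σ ∘ dropApex-⊆ σ _) (t∉dropApex σ)

  cone⇔bar : ∀ σ → Cone ⊤ₙ (bar (Λ n)) σ ⇔ (bar (Π n) σ × initSeg n ∉ σ)
  cone⇔bar σ = mk⇔ cone⇒bar λ (b , F∉σ) → bar⇒cone b F∉σ

lemmaA6 : (n : ℕ) → 1 ≤ n →
    CollapsesOnto (bar (Π n)) (Cone S.⊤ (bar (Λ n)))
lemmaA6 n 1≤n =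
  collapse-vertex-star (bar-Π-conedStar n) (bar-vertex (initSeg-nonempty 1≤n)) (cone⇔bar n)
  where open StarCollapse _≟ₛ_ (initSeg≢⊤ n)
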